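{- Let $K$ be a field of characteristic different from $2$ with algebraic closure $\overline{K}$, let $f(z)=z^2-1$, and let $x_0\in K$ with $x_0\neq0,-1$. Let $K_\infty:=\bigcup_{n\ge0}K(f^{ -n}(x_0))$ and $G_\infty:=\mathrm{Gal}(K_\infty/K)$. Choose primitive $2$-power roots of unity $\zeta_{2^m}\in K_\infty$ ($m\ge1$) with $(\zeta_{2^m})^2=\zeta_{2^{m-1}}$, and let $w\mapsto[w]$ be a labeling of the preimage tree of $x_0$ such that for every word $y$ over $\{a,b\}$ and every $i\ge0$, \[ \Bigg(\prod_{s_1,\ldots,s_i\in\{a,b\}}[y\,a\,s_1\,a\,s_2\cdots a\,s_i\,a]\Bigg)\Bigg(\prod_{s_1,\ldots,s_i\in\{a,b\}}[y\,b\,s_1\,a\,s_2\cdots a\,s_i\,a]\Bigg)^{ -1}=\zeta_{2^{i+1}}. \] Consider the embedding $G_\infty\hookrightarrow\mathrm{Aut}(T_\infty)$ induced by the action of $G_\infty$ on the preimage tree via this labeling. Then the image of this embedding is contained in the arithmetic basilica group $M_\infty$.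
   Context: $f^n$ is the $n$-th iterate and $f^{ -n}(x_0)$ is the set of roots of $f^n(z)=x_0$ in $\overline{K}$. A labeling of the preimage tree is a bijection $w\mapsto[w]$ from finite words over $\{a,b\}$ onto $\coprod_{n\ge0}f^{ -n}(x_0)$ with empty word $\mapsto x_0$, words of length $n$ mapping into $f^{ -n}(x_0)$, and $\{[wa],[wb]\}=f^{ -1}([w])$; $\sigma\in G_\infty$ acts on words by $\sigma([w])=[\sigma(w)]$. The word $y\,a\,s_1\cdots a\,s_i\,a$ is a concatenation. $T_\infty$ is the infinite binary rooted tree whose nodes at level $m$ are words of length $m$ over $\{a,b\}$ (root $x_0$ = empty word), $w$ joined to $wa,wb$; $\mathrm{Aut}(T_\infty)$ its root-preserving automorphism group. $\mathrm{Par}(\sigma,x)=0$ if $\sigma(xa)=\sigma(x)a$, $\sigma(xb)=\sigma(x)b$, and $=1$ if $\sigma(xa)=\sigma(x)b$, $\sigma(xb)=\sigma(x)a$. $Q(\sigma,x):=\sum_{i\ge0}2^i\sum_{s_1,\ldots,s_i\in\{a,b\}}\mathrm{Par}(\sigma,x\,a\,s_1\,a\,s_2\cdots a\,s_i)\in\mathbb{Z}_2$; $P(\sigma,x):=(-1)^{\mathrm{Par}(\sigma,x)}+2\sum_{t\in\{a,b\}}Q(\sigma,xbt)-2\sum_{t\in\{a,b\}}Q(\sigma,xat)\in\mathbb{Z}_2^\times$. The arithmetic basilica group is $M_\infty:=\{\sigma\in\mathrm{Aut}(T_\infty):P(\sigma,x)=P(\sigma,x_0)\text{ for all nodes }x\}$.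 -}

module Defs where

open import Level using (Level; _⊔_) renaming (suc to lsuc)
open import Algebra.Bundles using (CommutativeRing)
open import Data.Nat as ℕ using (ℕ; zero; suc)
open import Data.Integer as ℤ using (ℤ; +_)
open import Data.Integer.Divisibility using () renaming (_∣_ to _∣ℤ_)
open import Data.List using (List; []; _∷_; _++_; _∷ʳ_; length; map; concatMap; foldr)
open import Data.List.Properties using (≡-dec)
open import Data.Product using (Σ; ∃; _×_; _,_)
open import Data.Sum using (_⊎_)
open import Relation.Nullary using (¬_; yes; no; Dec)
open import Relation.Binary.PropositionalEquality using (_≡_; refl)

-- Words over {a,b} : nodes of T_∞ (level m = words of length m)

data Letter : Set where
  a b : Letter

_≟L_ : (s t : Letter) → Dec (s ≡ t)
a ≟L a = yes refl
a ≟L b = no λ ()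
b ≟L a = no λ ()
b ≟L b = yes refl

Word : Set
Word = List Letter

_≟W_ : (v w : Word) → Dec (v ≡ w)
_≟W_ = ≡-dec _≟L_

allWords : ℕ → List Word
allWords zero    = [] ∷ []
allWords (suc i) = concatMap (λ w → map (w ∷ʳ_) (a ∷ b ∷ [])) (allWords i)

aInterleave : Word → Word
aInterleave []      = []
aInterleave (s ∷ w) = a ∷ s ∷ aInterleave w

interleaveA : Word → Word
interleaveA []      = []
interleaveA (s ∷ w) = s ∷ a ∷ interleaveA w

IsTreeAut : (Word → Word) → Set
IsTreeAut τ =
    (∀ w → length (τ w) ≡ length w)
  × (∀ w t → ∃ λ t′ → τ (w ∷ʳ t) ≡ τ w ∷ʳ t′)
  × (∀ v w → τ v ≡ τ w → v ≡ w)
  × (∀ v → ∃ λ w → τ w ≡ v)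

Par : (Word → Word) → Word → ℕ
Par τ x with τ (x ∷ʳ a) ≟W (τ x ∷ʳ a)
... | yes _ = 0
... | no  _ = 1

sumℕ : List ℕ → ℕ
sumℕ = foldr ℕ._+_ 0

-- 2-adic integers, represented by sequences of integer approximations:
-- a sequence u : ℕ → ℤ represents the 2-adic limit with u k ≡ lim (mod 2^k).

_≡₂_ : (ℕ → ℤ) → (ℕ → ℤ) → Set
u ≡₂ v = ∀ k → (+ (2 ℕ.^ k)) ∣ℤ (u k ℤ.- v k)

Nsum : (Word → Word) → Word → ℕ → ℕ
Nsum τ x i = sumℕ (map (λ s → Par τ (x ++ aInterleave s)) (allWords i))

-- partial sums of Q(σ,x) = Σ_{i ≥ 0} 2^i N_i(σ,x): Qseq k = Σ_{i<k} 2^i N_i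
Qseq : (Word → Word) → Word → ℕ → ℕ
Qseq τ x zero    = 0
Qseq τ x (suc k) = Qseq τ x k ℕ.+ 2 ℕ.^ k ℕ.* Nsum τ x k

-- approximations of P(σ,x) = (-1)^Par + 2ΣQ(σ,xbt) - 2ΣQ(σ,xat); Pseq k ≡ P (mod 2^k)
signPar : ℕ → ℤ
signPar zero    = + 1
signPar (suc _) = ℤ.- (+ 1)

Pseq : (Word → Word) → Word → ℕ → ℤ
Pseq τ x k =
  signPar (Par τ x)
  ℤ.+ (+ 2) ℤ.* (+ (Qseq τ (x ++ b ∷ a ∷ []) k ℕ.+ Qseq τ (x ++ b ∷ b ∷ []) k))
  ℤ.- (+ 2) ℤ.* (+ (Qseq τ (x ++ a ∷ a ∷ []) k ℕ.+ Qseq τ (x ++ a ∷ b ∷ []) k))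

InM∞ : (Word → Word) → Set
InM∞ τ = IsTreeAut τ × (∀ x → Pseq τ x ≡₂ Pseq τ [])

module FieldDefs {c ℓ : Level} (R : CommutativeRing c ℓ) where
  open CommutativeRing R public

  IsField : Set (c ⊔ ℓ)
  IsField = (¬ (1# ≈ 0#)) × (∀ x → ¬ (x ≈ 0#) → ∃ λ y → x * y ≈ 1#)

  CharNot2 : Set ℓ
  CharNot2 = ¬ (1# + 1# ≈ 0#)

  _^′_ : Carrier → ℕ → Carrier
  x ^′ zero  = 1#
  x ^′ suc n = x * (x ^′ n)

  f : Carrier → Carrier
  f z = z * z - 1#

  iter : ℕ → Carrier → Carrier
  iter zero    z = z
  iter (suc n) z = f (iter n z)

  IsSubfield : (Carrier → Set ℓ) → Set (c ⊔ ℓ)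
  IsSubfield P =
      (∀ {x y} → x ≈ y → P x → P y)
    × P 0# × P 1#
    × (∀ {x y} → P x → P y → P (x + y))
    × (∀ {x} → P x → P (- x))
    × (∀ {x y} → P x → P y → P (x * y))
    × (∀ {x y} → P x → x * y ≈ 1# → P y)

  IsLabeling : Carrier → (Word → Carrier) → Set (c ⊔ ℓ)
  IsLabeling x₀ lab =
      lab [] ≈ x₀
    × (∀ w → iter (length w) (lab w) ≈ x₀)
    × (∀ v w → length v ≡ length w → lab v ≈ lab w → v ≡ w)
    × (∀ n z → iter n z ≈ x₀ → ∃ λ w → length w ≡ n × lab w ≈ z)
    × (∀ w → f (lab (w ∷ʳ a)) ≈ lab w × f (lab (w ∷ʳ b)) ≈ lab w
           × (∀ z → f z ≈ lab w → z ≈ lab (w ∷ʳ a) ⊎ z ≈ lab (w ∷ʳ b)))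

  -- L is generated over K by the labelled points (L = K_∞)
  GeneratedBy : (Carrier → Set ℓ) → (Word → Carrier) → Set (c ⊔ lsuc ℓ)
  GeneratedBy K lab =
    ∀ (P : Carrier → Set ℓ) → IsSubfield P → (∀ x → K x → P x)
      → (∀ w → P (lab w)) → ∀ x → P x

  -- ζ m stands for ζ_{2^(m+1)}
  IsRootSystem : (ℕ → Carrier) → Set ℓ
  IsRootSystem ζ =
      (∀ m → (ζ m ^′ (2 ℕ.^ suc m)) ≈ 1# × ¬ ((ζ m ^′ (2 ℕ.^ m)) ≈ 1#))
    × (∀ m → ζ (suc m) * ζ (suc m) ≈ ζ m)

  prodC : List Carrier → Carrier
  prodC = foldr _*_ 1#

  -- (∏_s [y a s₁ a ⋯ sᵢ a]) (∏_s [y b s₁ a ⋯ sᵢ a])⁻¹ = ζ_{2^{i+1}}, written multiplicatively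
  LabelingCompatible : (Word → Carrier) → (ℕ → Carrier) → Set ℓ
  LabelingCompatible lab ζ =
    ∀ y i → prodC (map (λ s → lab (y ++ a ∷ interleaveA s)) (allWords i))
            ≈ ζ i * prodC (map (λ s → lab (y ++ b ∷ interleaveA s)) (allWords i))

  IsKAut : (Carrier → Set ℓ) → (Carrier → Carrier) → Set (c ⊔ ℓ)
  IsKAut K σ =
      (∀ {x y} → x ≈ y → σ x ≈ σ y)
    × (∀ x y → σ (x + y) ≈ σ x + σ y)
    × (∀ x y → σ (x * y) ≈ σ x * σ y)
    × σ 1# ≈ 1#
    × (∀ x y → σ x ≈ σ y → x ≈ y)
    × (∀ y → ∃ λ x → σ x ≈ y)
    × (∀ x → K x → σ x ≈ x)

  Induces : (Word → Carrier) → (Carrier → Carrier) → (Word → Word) → Set ℓ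
  Induces lab σ τ = ∀ w → length (τ w) ≡ length w × σ (lab w) ≈ lab (τ w)

{-# OPTIONS --safe #-}
-- Let C_i(w) be the product of the labels [w s₁ a s₂ a ⋯ sᵢ a]; the hypothesis on the
-- labeling reads C_i(ya) = ζ_{2^{i+1}} C_i(yb). Splitting C_{i+1}(w) along its first letter
-- gives, by induction on i, σ(C_i(w)) · ζ_{2^{i+1}}^{2(Q(σ,wa)+Q(σ,wb))} = C_i(σ w), with Q
-- truncated after i terms. Applying σ to the hypothesis at a node y and comparing the two
-- sides then yields σ(ζ_{2^{i+1}}) = ζ_{2^{i+1}}^{P(σ,y)}. As ζ_{2^{i+1}} has order exactly
-- 2^{i+1}, P(σ,y) ≡ P(σ,x₀) (mod 2^{i+1}) for every node y and every i.
module Submission where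

open import Defs
open import Level using (Level)
open import Algebra.Bundles using (CommutativeRing)
open import Relation.Nullary using (¬_)
open import Data.Nat using (ℕ)

open import Data.Nat as ℕ using (zero; suc)
import Data.Nat.Properties as ℕ
import Data.Nat.Divisibility as ℕ
open import Data.Nat.Tactic.RingSolver using (solve-∀)
open import Data.Integer using (ℤ; +_)
import Data.Integer as ℤ
import Data.Integer.Properties as ℤ
import Data.Integer.Divisibility.Signed as ℤ
import Data.Integer.Tactic.RingSolver as ℤ
open import Data.List using (List; []; _∷_; _++_; _∷ʳ_; length; map; concatMap)
open import Data.List.Properties
  using (map-++; map-∘; map-cong; concatMap-++; length-++; ++-identityʳ; ∷ʳ-++; ∷ʳ-injectiveʳ)
open import Data.Nat.ListAction.Properties using (sum-++)
open import Data.Product using (∃; _×_; _,_; proj₁; proj₂)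
open import Data.Sum using (_⊎_; inj₁; inj₂)
open import Data.Empty using (⊥-elim)
open import Function using (_∘_)
open import Relation.Nullary using (yes; no)
open import Relation.Binary.PropositionalEquality as ≡ using (_≡_; cong; cong₂)

module Words where
  open Data.Nat using (_+_; _*_)
  open ≡ using (refl; sym; trans)
  open ≡.≡-Reasoning

  children : Word → List Word
  children w = map (w ∷ʳ_) (a ∷ b ∷ [])

  concatMap-children-map-∷ : ∀ t W →
    concatMap children (map (t ∷_) W) ≡ map (t ∷_) (concatMap children W)
  concatMap-children-map-∷ t []      = refl
  concatMap-children-map-∷ t (w ∷ W) =
    trans (cong (children (t ∷ w) ++_) (concatMap-children-map-∷ t W))
          (sym (map-++ (t ∷_) (children w) (concatMap children W)))

  allWords-suc : ∀ i → allWords (suc i) ≡ map (a ∷_) (allWords i) ++ map (b ∷_) (allWords i)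
  allWords-suc zero    = refl
  allWords-suc (suc i) = begin
    concatMap children (allWords (suc i))
      ≡⟨ cong (concatMap children) (allWords-suc i) ⟩
    concatMap children (map (a ∷_) W ++ map (b ∷_) W)
      ≡⟨ concatMap-++ children (map (a ∷_) W) (map (b ∷_) W) ⟩
    concatMap children (map (a ∷_) W) ++ concatMap children (map (b ∷_) W)
      ≡⟨ cong₂ _++_ (concatMap-children-map-∷ a W) (concatMap-children-map-∷ b W) ⟩
    map (a ∷_) (allWords (suc i)) ++ map (b ∷_) (allWords (suc i)) ∎
    where
    W : List Word
    W = allWords i

  map-allWords-suc : ∀ {ℓ} {A : Set ℓ} (g : Word → A) i →
    map g (allWords (suc i)) ≡ map (g ∘ (a ∷_)) (allWords i) ++ map (g ∘ (b ∷_)) (allWords i)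
  map-allWords-suc g i =
    trans (cong (map g) (allWords-suc i))
          (trans (map-++ g (map (a ∷_) (allWords i)) (map (b ∷_) (allWords i)))
                 (cong₂ _++_ (sym (map-∘ {g = g} (allWords i))) (sym (map-∘ {g = g} (allWords i)))))

  ∷ʳ-∷ʳ-++ : ∀ (w : Word) s t v → (w ∷ʳ s ∷ʳ t) ++ v ≡ w ++ s ∷ t ∷ v
  ∷ʳ-∷ʳ-++ w s t v = trans (∷ʳ-++ (w ∷ʳ s) t v) (∷ʳ-++ w s (t ∷ v))

  ∷ʳa≢∷ʳb : ∀ (w : Word) → ¬ (w ∷ʳ a ≡ w ∷ʳ b)
  ∷ʳa≢∷ʳb w e with ∷ʳ-injectiveʳ w w e
  ... | ()

  Par-keeps : ∀ τ x → τ (x ∷ʳ a) ≡ τ x ∷ʳ a → Par τ x ≡ 0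
  Par-keeps τ x e with τ (x ∷ʳ a) ≟W (τ x ∷ʳ a)
  ... | yes _ = refl
  ... | no ne = ⊥-elim (ne e)

  Par-swaps : ∀ τ x → ¬ (τ (x ∷ʳ a) ≡ τ x ∷ʳ a) → Par τ x ≡ 1
  Par-swaps τ x ne with τ (x ∷ʳ a) ≟W (τ x ∷ʳ a)
  ... | yes e = ⊥-elim (ne e)
  ... | no _  = refl

  data ChildAction (τ : Word → Word) (x : Word) : Set where
    keeps : Par τ x ≡ 0 → τ (x ∷ʳ a) ≡ τ x ∷ʳ a → τ (x ∷ʳ b) ≡ τ x ∷ʳ b → ChildAction τ x
    swaps : Par τ x ≡ 1 → τ (x ∷ʳ a) ≡ τ x ∷ʳ b → τ (x ∷ʳ b) ≡ τ x ∷ʳ a → ChildAction τ x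

  childAction : ∀ {τ} → IsTreeAut τ → ∀ x → ChildAction τ x
  childAction {τ} (_ , child , inj , _) x
    with τ (x ∷ʳ a) ≟W (τ x ∷ʳ a) | child x a | child x b
  ... | yes ea | _      | b , eb = keeps (Par-keeps τ x ea) ea eb
  ... | yes ea | _      | a , eb = ⊥-elim (∷ʳa≢∷ʳb x (inj _ _ (trans ea (sym eb))))
  ... | no ne  | a , ea | _      = ⊥-elim (ne ea)
  ... | no ne  | b , ea | a , eb = swaps (Par-swaps τ x ne) ea eb
  ... | no _   | b , ea | b , eb = ⊥-elim (∷ʳa≢∷ʳb x (inj _ _ (trans ea (sym eb))))

  Nsum-suc : ∀ τ v k → Nsum τ v (suc k) ≡ Nsum τ (v ∷ʳ a ∷ʳ a) k + Nsum τ (v ∷ʳ a ∷ʳ b) k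
  Nsum-suc τ v k = begin
    sumℕ (map h (allWords (suc k)))
      ≡⟨ cong sumℕ (map-allWords-suc h k) ⟩
    sumℕ (map (h ∘ (a ∷_)) W ++ map (h ∘ (b ∷_)) W)
      ≡⟨ sum-++ (map (h ∘ (a ∷_)) W) (map (h ∘ (b ∷_)) W) ⟩
    sumℕ (map (h ∘ (a ∷_)) W) + sumℕ (map (h ∘ (b ∷_)) W)
      ≡⟨ cong₂ _+_ (grandchild a) (grandchild b) ⟩
    Nsum τ (v ∷ʳ a ∷ʳ a) k + Nsum τ (v ∷ʳ a ∷ʳ b) k ∎
    where
    h : Word → ℕ
    h s = Par τ (v ++ aInterleave s)
    W : List Word
    W = allWords k
    grandchild : ∀ t → sumℕ (map (h ∘ (t ∷_)) W) ≡ Nsum τ (v ∷ʳ a ∷ʳ t) k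
    grandchild t = cong sumℕ (map-cong (λ s → cong (Par τ) (sym (∷ʳ-∷ʳ-++ v a t _))) W)

  Qchildren : (Word → Word) → Word → ℕ → ℕ
  Qchildren τ w i = Qseq τ (w ∷ʳ a) i + Qseq τ (w ∷ʳ b) i

  Qseq-suc-root : ∀ τ v k → Qseq τ v (suc k) ≡ Par τ v + 2 * Qchildren τ (v ∷ʳ a) k
  Qseq-suc-root τ v zero =
    cong (_+ 0) (trans (ℕ.+-identityʳ _) (cong (Par τ) (++-identityʳ v)))
  Qseq-suc-root τ v (suc k) = begin
    Qseq τ v (suc k) + 2 ℕ.^ suc k * Nsum τ v (suc k)
      ≡⟨ cong₂ _+_ (Qseq-suc-root τ v k) (cong (2 ℕ.^ suc k *_) (Nsum-suc τ v k)) ⟩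
    (Par τ v + 2 * Qchildren τ (v ∷ʳ a) k) + (2 * 2 ℕ.^ k) * (Nsum τ (v ∷ʳ a ∷ʳ a) k + Nsum τ (v ∷ʳ a ∷ʳ b) k)
      ≡⟨ regroup (Par τ v) (Qseq τ (v ∷ʳ a ∷ʳ a) k) (Qseq τ (v ∷ʳ a ∷ʳ b) k) (2 ℕ.^ k) _ _ ⟩
    Par τ v + 2 * Qchildren τ (v ∷ʳ a) (suc k) ∎
    where
    regroup : ∀ p q₁ q₂ e n₁ n₂ → (p + 2 * (q₁ + q₂)) + (2 * e) * (n₁ + n₂)
                                ≡ p + 2 * ((q₁ + e * n₁) + (q₂ + e * n₂))
    regroup = solve-∀
open Words

module Approximations where
  open Data.Integer using (_+_; _-_; _*_)
  open ≡ using (refl; trans)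
  open ≡.≡-Reasoning

  minusExp plusExp : (Word → Word) → Word → ℕ → ℕ
  minusExp τ y i = Par τ y ℕ.+ 2 ℕ.* Qchildren τ (y ∷ʳ a) i
  plusExp  τ y i = (1 ℕ.∸ Par τ y) ℕ.+ 2 ℕ.* Qchildren τ (y ∷ʳ b) i

  signPar-Par : ∀ τ x → signPar (Par τ x) ≡ + (1 ℕ.∸ Par τ x) - + Par τ x
  signPar-Par τ x with τ (x ∷ʳ a) ≟W (τ x ∷ʳ a)
  ... | yes _ = refl
  ... | no _  = refl

  pos-+-2* : ∀ m n → + (m ℕ.+ 2 ℕ.* n) ≡ + m + + 2 * + n
  pos-+-2* m n = trans (ℤ.pos-+ m (2 ℕ.* n)) (cong (_+_ (+ m)) (ℤ.pos-* 2 n))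

  Qchildren-∷ʳ : ∀ τ y s i →
    Qchildren τ (y ∷ʳ s) i ≡ Qseq τ (y ++ s ∷ a ∷ []) i ℕ.+ Qseq τ (y ++ s ∷ b ∷ []) i
  Qchildren-∷ʳ τ y s i =
    cong₂ ℕ._+_ (cong (λ v → Qseq τ v i) (∷ʳ-++ y s (a ∷ [])))
                (cong (λ v → Qseq τ v i) (∷ʳ-++ y s (b ∷ [])))

  Pseq-plusExp-minusExp : ∀ τ y i → Pseq τ y i ≡ + plusExp τ y i - + minusExp τ y i
  Pseq-plusExp-minusExp τ y i = begin
    signPar p + + 2 * + QB - + 2 * + QA
      ≡⟨ cong (λ s → s + + 2 * + QB - + 2 * + QA) (signPar-Par τ y) ⟩
    (+ (1 ℕ.∸ p) - + p) + + 2 * + QB - + 2 * + QA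
      ≡⟨ regroup (+ (1 ℕ.∸ p)) (+ p) (+ QB) (+ QA) ⟩
    (+ (1 ℕ.∸ p) + + 2 * + QB) - (+ p + + 2 * + QA)
      ≡⟨ cong₂ _-_ (trans (cong (λ q → + ((1 ℕ.∸ p) ℕ.+ 2 ℕ.* q)) (Qchildren-∷ʳ τ y b i))
                          (pos-+-2* (1 ℕ.∸ p) QB))
                   (trans (cong (λ q → + (p ℕ.+ 2 ℕ.* q)) (Qchildren-∷ʳ τ y a i))
                          (pos-+-2* p QA)) ⟨
    + plusExp τ y i - + minusExp τ y i ∎
    where
    p QA QB : ℕ
    p  = Par τ y
    QA = Qseq τ (y ++ a ∷ a ∷ []) i ℕ.+ Qseq τ (y ++ a ∷ b ∷ []) i
    QB = Qseq τ (y ++ b ∷ a ∷ []) i ℕ.+ Qseq τ (y ++ b ∷ b ∷ []) i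
    regroup : ∀ s⁺ s⁻ u v → (s⁺ - s⁻) + + 2 * u - + 2 * v ≡ (s⁺ + + 2 * u) - (s⁻ + + 2 * v)
    regroup = ℤ.solve-∀

  pos-Qseq-suc : ∀ q₁ q₂ e n₁ n₂ →
    + ((q₁ ℕ.+ e ℕ.* n₁) ℕ.+ (q₂ ℕ.+ e ℕ.* n₂)) ≡ + (q₁ ℕ.+ q₂) + + e * + (n₁ ℕ.+ n₂)
  pos-Qseq-suc q₁ q₂ e n₁ n₂ =
    trans (cong +_ (regroup q₁ q₂ e n₁ n₂))
          (trans (ℤ.pos-+ (q₁ ℕ.+ q₂) _) (cong (_+_ (+ (q₁ ℕ.+ q₂))) (ℤ.pos-* e _)))
    where
    regroup : ∀ q₁ q₂ e n₁ n₂ →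
      (q₁ ℕ.+ e ℕ.* n₁) ℕ.+ (q₂ ℕ.+ e ℕ.* n₂) ≡ (q₁ ℕ.+ q₂) ℕ.+ e ℕ.* (n₁ ℕ.+ n₂)
    regroup = solve-∀

  Pseq-suc-∣ : ∀ τ y i → + (2 ℕ.^ suc i) ℤ.∣ Pseq τ y (suc i) - Pseq τ y i
  Pseq-suc-∣ τ y i = ℤ.divides (NB - NA) (begin
    Pseq τ y (suc i) - Pseq τ y i
      ≡⟨ cong₂ (λ u v → (signPar (Par τ y) + + 2 * u - + 2 * v) - Pseq τ y i)
               (pos-Qseq-suc (Q b a) (Q b b) E (N b a) (N b b))
               (pos-Qseq-suc (Q a a) (Q a b) E (N a a) (N a b)) ⟩
    (signPar (Par τ y) + + 2 * (QB + + E * NB) - + 2 * (QA + + E * NA))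
      - (signPar (Par τ y) + + 2 * QB - + 2 * QA)
      ≡⟨ regroup (signPar (Par τ y)) QA QB (+ E) NA NB ⟩
    (NB - NA) * (+ 2 * + E)
      ≡⟨ cong ((NB - NA) *_) (ℤ.pos-* 2 E) ⟨
    (NB - NA) * + (2 ℕ.^ suc i) ∎)
    where
    E : ℕ
    E = 2 ℕ.^ i
    Q N : Letter → Letter → ℕ
    Q s t = Qseq τ (y ++ s ∷ t ∷ []) i
    N s t = Nsum τ (y ++ s ∷ t ∷ []) i
    QA QB NA NB : ℤ
    QA = + (Q a a ℕ.+ Q a b)
    QB = + (Q b a ℕ.+ Q b b)
    NA = + (N a a ℕ.+ N a b)
    NB = + (N b a ℕ.+ N b b)
    regroup : ∀ s qa qb e na nb →
      (s + + 2 * (qb + e * nb) - + 2 * (qa + e * na)) - (s + + 2 * qb - + 2 * qa)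
      ≡ (nb - na) * (+ 2 * e)
    regroup = ℤ.solve-∀

  ∣-difference-transfer : ∀ {k} x x′ y y′ →
    k ℤ.∣ x - x′ → k ℤ.∣ y - y′ → k ℤ.∣ x′ - y′ → k ℤ.∣ x - y
  ∣-difference-transfer {k} x x′ y y′ kx ky kx′y′ =
    ≡.subst (k ℤ.∣_) (regroup x x′ y y′) (ℤ.∣m∣n⇒∣m+n (ℤ.∣m∣n⇒∣m-n kx ky) kx′y′)
    where
    regroup : ∀ x x′ y y′ → (x - x′) - (y - y′) + (x′ - y′) ≡ x - y
    regroup = ℤ.solve-∀
open Approximations

module RingTheory {c ℓ : Level} (R : CommutativeRing c ℓ) where
  open FieldDefs R
  open import Algebra.Properties.CommutativeSemiring.Exp commutativeSemiring
    using (_^_; ^-congˡ; ^-homo-*; ^-assocʳ; ^-distrib-*)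
  open import Algebra.Properties.CommutativeSemigroup *-commutativeSemigroup
    using (interchange; xy∙z≈y∙xz; x∙yz≈y∙xz; x∙yz≈xz∙y; x∙yz≈yx∙z)
  open import Algebra.Properties.Ring ring using (-1*x≈-x; -‿involutive; +-inverseʳ-unique; x+x≈x⇒x≈0)
  open import Relation.Binary.Reasoning.Setoid setoid

  ^-2 : ∀ x → x ^ 2 ≈ x * x
  ^-2 x = *-congˡ (*-identityʳ x)

  prodC-++ : ∀ xs ys → prodC (xs ++ ys) ≈ prodC xs * prodC ys
  prodC-++ []       ys = sym (*-identityˡ _)
  prodC-++ (x ∷ xs) ys = trans (*-congˡ (prodC-++ xs ys)) (sym (*-assoc _ _ _))

  prodC-allWords-suc : ∀ (g : Word → Carrier) i →
    prodC (map g (allWords (suc i)))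
      ≈ prodC (map (g ∘ (a ∷_)) (allWords i)) * prodC (map (g ∘ (b ∷_)) (allWords i))
  prodC-allWords-suc g i = trans (reflexive (cong prodC (map-allWords-suc g i)))
    (prodC-++ (map (g ∘ (a ∷_)) (allWords i)) (map (g ∘ (b ∷_)) (allWords i)))

  f-cong : ∀ {x y} → x ≈ y → f x ≈ f y
  f-cong e = +-congʳ (*-cong e e)

  iter-cong : ∀ n {x y} → x ≈ y → iter n x ≈ iter n y
  iter-cong zero    e = e
  iter-cong (suc n) e = f-cong (iter-cong n e)

  iter-0 : ∀ n → iter n 0# ≈ 0# ⊎ iter n 0# ≈ - 1#
  iter-0 zero = inj₁ refl
  iter-0 (suc n) with iter-0 n
  ... | inj₁ e = inj₂ (begin
    iter n 0# * iter n 0# - 1# ≈⟨ +-congʳ (trans (*-congˡ e) (zeroʳ _)) ⟩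
    0# - 1#                    ≈⟨ +-identityˡ _ ⟩
    - 1#                       ∎)
  ... | inj₂ e = inj₁ (begin
    iter n 0# * iter n 0# - 1# ≈⟨ +-congʳ (*-cong e e) ⟩
    - 1# * - 1# - 1#           ≈⟨ +-congʳ (trans (-1*x≈-x (- 1#)) (-‿involutive 1#)) ⟩
    1# - 1#                    ≈⟨ -‿inverseʳ 1# ⟩
    0#                         ∎)

  module Field (isField : IsField) where
    1≉0 : ¬ (1# ≈ 0#)
    1≉0 = proj₁ isField

    *-cancelˡ : ∀ {x y z} → ¬ (x ≈ 0#) → x * y ≈ x * z → y ≈ z
    *-cancelˡ {x} {y} {z} x≉0 e with proj₂ isField x x≉0
    ... | x⁻¹ , xx⁻¹ = begin
      y              ≈⟨ *-identityˡ y ⟨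
      1# * y         ≈⟨ *-congʳ (trans (sym xx⁻¹) (*-comm x x⁻¹)) ⟩
      (x⁻¹ * x) * y  ≈⟨ *-assoc _ _ _ ⟩
      x⁻¹ * (x * y)  ≈⟨ *-congˡ e ⟩
      x⁻¹ * (x * z)  ≈⟨ *-assoc _ _ _ ⟨
      (x⁻¹ * x) * z  ≈⟨ *-congʳ (trans (*-comm x⁻¹ x) xx⁻¹) ⟩
      1# * z         ≈⟨ *-identityˡ z ⟩
      z              ∎

    *-≉0 : ∀ {x y} → ¬ (x ≈ 0#) → ¬ (y ≈ 0#) → ¬ (x * y ≈ 0#)
    *-≉0 {x} x≉0 y≉0 e = y≉0 (*-cancelˡ x≉0 (trans e (sym (zeroʳ x))))

    ^-≉0 : ∀ {x} n → ¬ (x ≈ 0#) → ¬ (x ^ n ≈ 0#)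
    ^-≉0 zero    x≉0 = 1≉0
    ^-≉0 (suc n) x≉0 = *-≉0 x≉0 (^-≉0 n x≉0)

    prodC-≉0 : ∀ (g : Word → Carrier) W → (∀ s → ¬ (g s ≈ 0#)) → ¬ (prodC (map g W) ≈ 0#)
    prodC-≉0 g []      g≉0 = 1≉0
    prodC-≉0 g (s ∷ W) g≉0 = *-≉0 (g≉0 s) (prodC-≉0 g W g≉0)

    module RootsOfUnity (ζ : ℕ → Carrier) (isRootSystem : IsRootSystem ζ) where
      ζ-suc² : ∀ i → ζ (suc i) * ζ (suc i) ≈ ζ i
      ζ-suc² = proj₂ isRootSystem

      ζ-suc-^-2* : ∀ i n → ζ (suc i) ^ (2 ℕ.* n) ≈ ζ i ^ n
      ζ-suc-^-2* i n = begin
        ζ (suc i) ^ (2 ℕ.* n)   ≈⟨ ^-assocʳ (ζ (suc i)) 2 n ⟨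
        (ζ (suc i) ^ 2) ^ n     ≈⟨ ^-congˡ n (trans (^-2 _) (ζ-suc² i)) ⟩
        ζ i ^ n                 ∎

      ζ₀² : ζ 0 ^ 2 ≈ 1#
      ζ₀² = proj₁ (proj₁ isRootSystem 0)

      ζ≉0 : ∀ i → ¬ (ζ i ≈ 0#)
      ζ≉0 zero    e = 1≉0 (trans (sym ζ₀²) (trans (^-2 _) (trans (*-congˡ e) (zeroʳ _))))
      ζ≉0 (suc i) e = ζ≉0 i (trans (sym (ζ-suc² i)) (trans (*-congˡ e) (zeroʳ _)))

      ζ₀-order : ∀ m → ζ 0 ^ m ≈ 1# → 2 ℕ.∣ m
      ζ₀-order zero          _ = 2 ℕ.∣0
      ζ₀-order (suc zero)    e = ⊥-elim (proj₂ (proj₁ isRootSystem 0) e)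
      ζ₀-order (suc (suc m)) e = ℕ.∣m∣n⇒∣m+n ℕ.∣-refl (ζ₀-order m (begin
        ζ 0 ^ m              ≈⟨ *-identityˡ _ ⟨
        1# * ζ 0 ^ m         ≈⟨ *-congʳ ζ₀² ⟨
        ζ 0 ^ 2 * ζ 0 ^ m    ≈⟨ ^-homo-* (ζ 0) 2 m ⟨
        ζ 0 ^ (2 ℕ.+ m)      ≈⟨ e ⟩
        1#                   ∎))

      ζ-suc-^≈1⇒ζ-^≈1 : ∀ i m → ζ (suc i) ^ m ≈ 1# → ζ i ^ m ≈ 1#
      ζ-suc-^≈1⇒ζ-^≈1 i m e = begin
        ζ i ^ m                        ≈⟨ ^-congˡ m (ζ-suc² i) ⟨
        (ζ (suc i) * ζ (suc i)) ^ m    ≈⟨ ^-distrib-* _ _ m ⟩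
        ζ (suc i) ^ m * ζ (suc i) ^ m  ≈⟨ *-cong e e ⟩
        1# * 1#                        ≈⟨ *-identityˡ 1# ⟩
        1#                             ∎

      ζ-order : ∀ i m → ζ i ^ m ≈ 1# → 2 ℕ.^ suc i ℕ.∣ m
      ζ-order zero    m e = ≡.subst (ℕ._∣ m) (≡.sym (ℕ.*-identityʳ 2)) (ζ₀-order m e)
      -- ζᵢ^m = 1 makes m even, m = 2q, and then ζᵢ^q = ζᵢ₊₁^m = 1.
      ζ-order (suc i) m e with ℕ.∣-trans (ℕ.m∣m*n (2 ℕ.^ i)) (ζ-order i m (ζ-suc-^≈1⇒ζ-^≈1 i m e))
      ... | ℕ.divides q m≡q*2 =
        ≡.subst (2 ℕ.^ suc (suc i) ℕ.∣_) (≡.sym m≡2*q) (ℕ.*-monoʳ-∣ 2 (ζ-order i q ζᵢ^q≈1))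
        where
        m≡2*q : m ≡ 2 ℕ.* q
        m≡2*q = ≡.trans m≡q*2 (ℕ.*-comm q 2)
        ζᵢ^q≈1 : ζ i ^ q ≈ 1#
        ζᵢ^q≈1 = trans (sym (ζ-suc-^-2* i q)) (trans (reflexive (cong (ζ (suc i) ^_) (≡.sym m≡2*q))) e)

      ζ-^-≈⇒∣∸ : ∀ i {m n} → n ℕ.≤ m → ζ i ^ m ≈ ζ i ^ n → 2 ℕ.^ suc i ℕ.∣ m ℕ.∸ n
      ζ-^-≈⇒∣∸ i {m} {n} n≤m e = ζ-order i (m ℕ.∸ n) (*-cancelˡ (^-≉0 n (ζ≉0 i)) (begin
        ζ i ^ n * ζ i ^ (m ℕ.∸ n)   ≈⟨ ^-homo-* (ζ i) n (m ℕ.∸ n) ⟨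
        ζ i ^ (n ℕ.+ (m ℕ.∸ n))     ≈⟨ reflexive (cong (ζ i ^_) (ℕ.m+[n∸m]≡n n≤m)) ⟩
        ζ i ^ m                     ≈⟨ e ⟩
        ζ i ^ n                     ≈⟨ *-identityʳ _ ⟨
        ζ i ^ n * 1#                ∎))

      ζ-^-≈⇒∣ : ∀ i m n → ζ i ^ m ≈ ζ i ^ n → + (2 ℕ.^ suc i) ℤ.∣ + m ℤ.- + n
      ζ-^-≈⇒∣ i m n e with ℕ.≤-total n m
      ... | inj₁ n≤m =
        ≡.subst (+ (2 ℕ.^ suc i) ℤ.∣_) (≡.sym (≡.trans (ℤ.m-n≡m⊖n m n) (ℤ.⊖-≥ n≤m)))
          (ℤ.∣ᵤ⇒∣ (ζ-^-≈⇒∣∸ i n≤m e))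
      ... | inj₂ m≤n =
        ≡.subst (+ (2 ℕ.^ suc i) ℤ.∣_) (≡.sym (≡.trans (ℤ.m-n≡m⊖n m n) (ℤ.⊖-≤ m≤n)))
          (ℤ.∣m⇒∣-m (ℤ.∣ᵤ⇒∣ (ζ-^-≈⇒∣∸ i m≤n (sym e))))

      ζ-exponent-∣ : ∀ i {c u v u′ v′} → c * ζ i ^ u ≈ ζ i ^ v → c * ζ i ^ u′ ≈ ζ i ^ v′ →
        + (2 ℕ.^ suc i) ℤ.∣ (+ v ℤ.- + u) ℤ.- (+ v′ ℤ.- + u′)
      ζ-exponent-∣ i {c} {u} {v} {u′} {v′} e e′ =
        ≡.subst (+ (2 ℕ.^ suc i) ℤ.∣_) +[v+u′]-+[u+v′]
          (ζ-^-≈⇒∣ i (v ℕ.+ u′) (u ℕ.+ v′) (begin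
            ζ i ^ (v ℕ.+ u′)          ≈⟨ ^-homo-* (ζ i) v u′ ⟩
            ζ i ^ v * ζ i ^ u′        ≈⟨ *-congʳ e ⟨
            (c * ζ i ^ u) * ζ i ^ u′  ≈⟨ xy∙z≈y∙xz _ _ _ ⟩
            ζ i ^ u * (c * ζ i ^ u′)  ≈⟨ *-congˡ e′ ⟩
            ζ i ^ u * ζ i ^ v′        ≈⟨ ^-homo-* (ζ i) u v′ ⟨
            ζ i ^ (u ℕ.+ v′)          ∎))
        where
        +[v+u′]-+[u+v′] : + (v ℕ.+ u′) ℤ.- + (u ℕ.+ v′) ≡ (+ v ℤ.- + u) ℤ.- (+ v′ ℤ.- + u′)
        +[v+u′]-+[u+v′] = ≡.trans (cong₂ ℤ._-_ (ℤ.pos-+ v u′) (ℤ.pos-+ u v′))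
                                  (regroup (+ v) (+ u′) (+ u) (+ v′))
          where
          regroup : ∀ v u′ u v′ → (v ℤ.+ u′) ℤ.- (u ℤ.+ v′) ≡ (v ℤ.- u) ℤ.- (v′ ℤ.- u′)
          regroup = ℤ.solve-∀

  module Automorphism (K : Carrier → Set ℓ) (σ : Carrier → Carrier) (isKAut : IsKAut K σ) where
    σ-cong : ∀ {x y} → x ≈ y → σ x ≈ σ y
    σ-cong = proj₁ isKAut

    σ-+ : ∀ x y → σ (x + y) ≈ σ x + σ y
    σ-+ = proj₁ (proj₂ isKAut)

    σ-* : ∀ x y → σ (x * y) ≈ σ x * σ y
    σ-* = proj₁ (proj₂ (proj₂ isKAut))

    σ-1 : σ 1# ≈ 1#
    σ-1 = proj₁ (proj₂ (proj₂ (proj₂ isKAut)))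

    σ-injective : ∀ x y → σ x ≈ σ y → x ≈ y
    σ-injective = proj₁ (proj₂ (proj₂ (proj₂ (proj₂ isKAut))))

    σ-surjective : ∀ y → ∃ λ x → σ x ≈ y
    σ-surjective = proj₁ (proj₂ (proj₂ (proj₂ (proj₂ (proj₂ isKAut)))))

    σ-fixes-K : ∀ x → K x → σ x ≈ x
    σ-fixes-K = proj₂ (proj₂ (proj₂ (proj₂ (proj₂ (proj₂ isKAut)))))

    σ-0 : σ 0# ≈ 0#
    σ-0 = x+x≈x⇒x≈0 (σ 0#) (trans (sym (σ-+ 0# 0#)) (σ-cong (+-identityˡ 0#)))

    σ-neg : ∀ x → σ (- x) ≈ - σ x
    σ-neg x = +-inverseʳ-unique (σ x) (σ (- x))
      (trans (sym (σ-+ x (- x))) (trans (σ-cong (-‿inverseʳ x)) σ-0))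

    σ-≉0 : ∀ {x} → ¬ (x ≈ 0#) → ¬ (σ x ≈ 0#)
    σ-≉0 x≉0 e = x≉0 (σ-injective _ _ (trans e (sym σ-0)))

    σ-f : ∀ z → σ (f z) ≈ f (σ z)
    σ-f z = begin
      σ (z * z - 1#)        ≈⟨ σ-+ _ _ ⟩
      σ (z * z) + σ (- 1#)  ≈⟨ +-cong (σ-* z z) (trans (σ-neg 1#) (-‿cong σ-1)) ⟩
      σ z * σ z - 1#        ∎

    σ-iter : ∀ n z → σ (iter n z) ≈ iter n (σ z)
    σ-iter zero    z = refl
    σ-iter (suc n) z = trans (σ-f _) (f-cong (σ-iter n z))

  module Labeling (x₀ : Carrier) (x₀≉0 : ¬ (x₀ ≈ 0#)) (x₀≉-1 : ¬ (x₀ ≈ - 1#))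
                  (lab : Word → Carrier) (isLabeling : IsLabeling x₀ lab) where
    lab-iter : ∀ w → iter (length w) (lab w) ≈ x₀
    lab-iter = proj₁ (proj₂ isLabeling)

    lab-injective : ∀ v w → length v ≡ length w → lab v ≈ lab w → v ≡ w
    lab-injective = proj₁ (proj₂ (proj₂ isLabeling))

    lab-surjective : ∀ n z → iter n z ≈ x₀ → ∃ λ w → length w ≡ n × lab w ≈ z
    lab-surjective = proj₁ (proj₂ (proj₂ (proj₂ isLabeling)))

    lab-child : ∀ w t → f (lab (w ∷ʳ t)) ≈ lab w
    lab-child w a = proj₁ (proj₂ (proj₂ (proj₂ (proj₂ isLabeling))) w)
    lab-child w b = proj₁ (proj₂ (proj₂ (proj₂ (proj₂ (proj₂ isLabeling))) w))

    lab-preimage : ∀ w z → f z ≈ lab w → z ≈ lab (w ∷ʳ a) ⊎ z ≈ lab (w ∷ʳ b)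
    lab-preimage w = proj₂ (proj₂ (proj₂ (proj₂ (proj₂ (proj₂ isLabeling))) w))

    -- The forward orbit of 0 is {0, -1}, which does not contain x₀.
    lab-≉0 : ∀ w → ¬ (lab w ≈ 0#)
    lab-≉0 w e with iter-0 (length w)
    ... | inj₁ e′ = x₀≉0 (trans (sym (lab-iter w)) (trans (iter-cong (length w) e) e′))
    ... | inj₂ e′ = x₀≉-1 (trans (sym (lab-iter w)) (trans (iter-cong (length w) e) e′))

    module InducedAction (K : Carrier → Set ℓ) (Kx₀ : K x₀)
                         (σ : Carrier → Carrier) (isKAut : IsKAut K σ)
                         (τ : Word → Word) (induces : Induces lab σ τ) where
      open Automorphism K σ isKAut

      τ-length : ∀ w → length (τ w) ≡ length w
      τ-length w = proj₁ (induces w)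

      σ-lab : ∀ w → σ (lab w) ≈ lab (τ w)
      σ-lab w = proj₂ (induces w)

      τ-injective : ∀ v w → τ v ≡ τ w → v ≡ w
      τ-injective v w e = lab-injective v w
        (≡.trans (≡.sym (τ-length v)) (≡.trans (cong length e) (τ-length w)))
        (σ-injective _ _ (trans (σ-lab v) (trans (reflexive (cong lab e)) (sym (σ-lab w)))))

      length-τ-∷ʳ : ∀ w t t′ → length (τ (w ∷ʳ t)) ≡ length (τ w ∷ʳ t′)
      length-τ-∷ʳ w t t′ =
        ≡.trans (τ-length (w ∷ʳ t)) (≡.trans (length-++ w)
          (≡.trans (cong (ℕ._+ 1) (≡.sym (τ-length w))) (≡.sym (length-++ (τ w)))))

      f-lab-τ-∷ʳ : ∀ w t → f (lab (τ (w ∷ʳ t))) ≈ lab (τ w)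
      f-lab-τ-∷ʳ w t = begin
        f (lab (τ (w ∷ʳ t))) ≈⟨ f-cong (σ-lab (w ∷ʳ t)) ⟨
        f (σ (lab (w ∷ʳ t))) ≈⟨ σ-f _ ⟨
        σ (f (lab (w ∷ʳ t))) ≈⟨ σ-cong (lab-child w t) ⟩
        σ (lab w)            ≈⟨ σ-lab w ⟩
        lab (τ w)            ∎

      τ-child : ∀ w t → ∃ λ t′ → τ (w ∷ʳ t) ≡ τ w ∷ʳ t′
      τ-child w t with lab-preimage (τ w) (lab (τ (w ∷ʳ t))) (f-lab-τ-∷ʳ w t)
      ... | inj₁ e = a , lab-injective _ _ (length-τ-∷ʳ w t a) e
      ... | inj₂ e = b , lab-injective _ _ (length-τ-∷ʳ w t b) e

      τ-surjective : ∀ v → ∃ λ w → τ w ≡ v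
      τ-surjective v with σ-surjective (lab v)
      ... | x , σx≈lab-v with lab-surjective (length v) x (σ-injective _ _ (begin
            σ (iter (length v) x)   ≈⟨ σ-iter (length v) x ⟩
            iter (length v) (σ x)   ≈⟨ iter-cong (length v) σx≈lab-v ⟩
            iter (length v) (lab v) ≈⟨ lab-iter v ⟩
            x₀                      ≈⟨ σ-fixes-K x₀ Kx₀ ⟨
            σ x₀                    ∎))
      ... | w , length-w , lab-w≈x = w , lab-injective _ _ (≡.trans (τ-length w) length-w)
            (trans (sym (σ-lab w)) (trans (σ-cong lab-w≈x) σx≈lab-v))

      τ-isTreeAut : IsTreeAut τ
      τ-isTreeAut = τ-length , τ-child , τ-injective , τ-surjective

      module Basilica (isField : IsField) (ζ : ℕ → Carrier) (isRootSystem : IsRootSystem ζ)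
                      (compatible : LabelingCompatible lab ζ) where
        open Field isField
        open RootsOfUnity ζ isRootSystem

        C : ℕ → Word → Carrier
        C i w = prodC (map (λ s → lab (w ++ interleaveA s)) (allWords i))

        C-zero : ∀ w → C 0 w ≈ lab w
        C-zero w = trans (*-identityʳ _) (reflexive (cong lab (++-identityʳ w)))

        C-suc : ∀ i w → C (suc i) w ≈ C i (w ∷ʳ a ∷ʳ a) * C i (w ∷ʳ b ∷ʳ a)
        C-suc i w = trans (prodC-allWords-suc (λ s → lab (w ++ interleaveA s)) i)
                          (*-cong (grandchild a) (grandchild b))
          where
          grandchild : ∀ t → prodC (map (λ s → lab (w ++ t ∷ a ∷ interleaveA s)) (allWords i))
                             ≈ C i (w ∷ʳ t ∷ʳ a)
          grandchild t = reflexive (cong prodC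
            (map-cong (λ s → cong lab (≡.sym (∷ʳ-∷ʳ-++ w t a (interleaveA s)))) (allWords i)))

        C-compatible : ∀ y i → C i (y ∷ʳ a) ≈ ζ i * C i (y ∷ʳ b)
        C-compatible y i =
          trans (reflexive (C-∷ʳ a)) (trans (compatible y i) (*-congˡ (reflexive (≡.sym (C-∷ʳ b)))))
          where
          C-∷ʳ : ∀ t → C i (y ∷ʳ t) ≡ prodC (map (λ s → lab (y ++ t ∷ interleaveA s)) (allWords i))
          C-∷ʳ t = cong prodC (map-cong (λ s → cong lab (∷ʳ-++ y t (interleaveA s))) (allWords i))

        C-≉0 : ∀ i w → ¬ (C i w ≈ 0#)
        C-≉0 i w = prodC-≉0 _ (allWords i) (λ s → lab-≉0 (w ++ interleaveA s))

        C-τ-∷ʳa : ∀ i u → C i (τ (u ∷ʳ a)) * ζ i ^ Par τ u ≈ C i (τ u ∷ʳ a)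
        C-τ-∷ʳa i u with childAction τ-isTreeAut u
        ... | keeps p ea _ = begin
          C i (τ (u ∷ʳ a)) * ζ i ^ Par τ u
            ≈⟨ *-cong (reflexive (cong (C i) ea)) (reflexive (cong (ζ i ^_) p)) ⟩
          C i (τ u ∷ʳ a) * 1#             ≈⟨ *-identityʳ _ ⟩
          C i (τ u ∷ʳ a)                  ∎
        ... | swaps p ea _ = begin
          C i (τ (u ∷ʳ a)) * ζ i ^ Par τ u
            ≈⟨ *-cong (reflexive (cong (C i) ea)) (reflexive (cong (ζ i ^_) p)) ⟩
          C i (τ u ∷ʳ b) * (ζ i * 1#)     ≈⟨ *-comm _ _ ⟩
          (ζ i * 1#) * C i (τ u ∷ʳ b)     ≈⟨ *-congʳ (*-identityʳ _) ⟩
          ζ i * C i (τ u ∷ʳ b)            ≈⟨ C-compatible (τ u) i ⟨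
          C i (τ u ∷ʳ a)                  ∎

        C-τ-children : ∀ i w → C i (τ (w ∷ʳ a) ∷ʳ a) * C i (τ (w ∷ʳ b) ∷ʳ a) ≈ C (suc i) (τ w)
        C-τ-children i w with childAction τ-isTreeAut w
        ... | keeps _ ea eb = trans (reflexive (cong₂ (λ u v → C i (u ∷ʳ a) * C i (v ∷ʳ a)) ea eb))
                                   (sym (C-suc i (τ w)))
        ... | swaps _ ea eb = trans (reflexive (cong₂ (λ u v → C i (u ∷ʳ a) * C i (v ∷ʳ a)) ea eb))
                                   (trans (*-comm _ _) (sym (C-suc i (τ w))))

        σ-C : ∀ i w → σ (C i w) * ζ i ^ (2 ℕ.* Qchildren τ w i) ≈ C i (τ w)
        σ-C zero w =
          trans (*-identityʳ _) (trans (σ-cong (C-zero w)) (trans (σ-lab w) (sym (C-zero (τ w)))))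
        σ-C (suc i) w = begin
          σ (C (suc i) w) * ζ (suc i) ^ (2 ℕ.* Qchildren τ w (suc i))
            ≈⟨ *-cong (trans (σ-cong (C-suc i w)) (σ-* _ _))
                      (trans (ζ-suc-^-2* i (Qchildren τ w (suc i)))
                             (^-homo-* (ζ i) (Qseq τ (w ∷ʳ a) (suc i)) (Qseq τ (w ∷ʳ b) (suc i)))) ⟩
          (σ (C i (w ∷ʳ a ∷ʳ a)) * σ (C i (w ∷ʳ b ∷ʳ a))) * (Z a * Z b)
            ≈⟨ interchange _ _ _ _ ⟩
          (σ (C i (w ∷ʳ a ∷ʳ a)) * Z a) * (σ (C i (w ∷ʳ b ∷ʳ a)) * Z b)
            ≈⟨ *-cong (σ-C-∷ʳ a) (σ-C-∷ʳ b) ⟩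
          C i (τ (w ∷ʳ a) ∷ʳ a) * C i (τ (w ∷ʳ b) ∷ʳ a)
            ≈⟨ C-τ-children i w ⟩
          C (suc i) (τ w) ∎
          where
          Z : Letter → Carrier
          Z t = ζ i ^ Qseq τ (w ∷ʳ t) (suc i)
          σ-C-∷ʳ : ∀ t → σ (C i (w ∷ʳ t ∷ʳ a)) * Z t ≈ C i (τ (w ∷ʳ t) ∷ʳ a)
          σ-C-∷ʳ t = begin
            σ grandchild * Z t
              ≈⟨ *-congˡ (reflexive (cong (ζ i ^_) (Qseq-suc-root τ (w ∷ʳ t) i))) ⟩
            σ grandchild * ζ i ^ (Par τ (w ∷ʳ t) ℕ.+ 2 ℕ.* Qchildren τ (w ∷ʳ t ∷ʳ a) i)
              ≈⟨ *-congˡ (^-homo-* (ζ i) (Par τ (w ∷ʳ t)) (2 ℕ.* Qchildren τ (w ∷ʳ t ∷ʳ a) i)) ⟩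
            σ grandchild * (ζ i ^ Par τ (w ∷ʳ t) * ζ i ^ (2 ℕ.* Qchildren τ (w ∷ʳ t ∷ʳ a) i))
              ≈⟨ x∙yz≈xz∙y _ _ _ ⟩
            (σ grandchild * ζ i ^ (2 ℕ.* Qchildren τ (w ∷ʳ t ∷ʳ a) i)) * ζ i ^ Par τ (w ∷ʳ t)
              ≈⟨ *-congʳ (σ-C i (w ∷ʳ t ∷ʳ a)) ⟩
            C i (τ (w ∷ʳ t ∷ʳ a)) * ζ i ^ Par τ (w ∷ʳ t)
              ≈⟨ C-τ-∷ʳa i (w ∷ʳ t) ⟩
            C i (τ (w ∷ʳ t) ∷ʳ a) ∎
            where
            grandchild : Carrier
            grandchild = C i (w ∷ʳ t ∷ʳ a)

        -- σ acts on ζᵢ as the power P(σ,y) mod 2^(i+1), whatever the node y.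
        σ-ζ : ∀ i y → σ (ζ i) * ζ i ^ minusExp τ y i ≈ ζ i ^ plusExp τ y i
        σ-ζ i y = *-cancelˡ (σ-≉0 (C-≉0 i (y ∷ʳ b))) (action (childAction τ-isTreeAut y))
          where
          A B : ℕ
          A = 2 ℕ.* Qchildren τ (y ∷ʳ a) i
          B = 2 ℕ.* Qchildren τ (y ∷ʳ b) i
          sA sB : Carrier
          sA = σ (C i (y ∷ʳ a))
          sB = σ (C i (y ∷ʳ b))
          sA≈σζsB : sA ≈ σ (ζ i) * sB
          sA≈σζsB = trans (σ-cong (C-compatible y i)) (σ-* _ _)
          action : ChildAction τ y →
                   sB * (σ (ζ i) * ζ i ^ minusExp τ y i) ≈ sB * ζ i ^ plusExp τ y i
          action (keeps p ea eb) = begin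
            sB * (σ (ζ i) * ζ i ^ minusExp τ y i)
              ≈⟨ *-congˡ (*-congˡ (reflexive (cong (λ q → ζ i ^ (q ℕ.+ A)) p))) ⟩
            sB * (σ (ζ i) * ζ i ^ A)     ≈⟨ x∙yz≈yx∙z _ _ _ ⟩
            (σ (ζ i) * sB) * ζ i ^ A     ≈⟨ *-congʳ sA≈σζsB ⟨
            sA * ζ i ^ A                 ≈⟨ σ-C i (y ∷ʳ a) ⟩
            C i (τ (y ∷ʳ a))             ≈⟨ reflexive (cong (C i) ea) ⟩
            C i (τ y ∷ʳ a)               ≈⟨ C-compatible (τ y) i ⟩
            ζ i * C i (τ y ∷ʳ b)         ≈⟨ *-congˡ (reflexive (cong (C i) eb)) ⟨
            ζ i * C i (τ (y ∷ʳ b))       ≈⟨ *-congˡ (σ-C i (y ∷ʳ b)) ⟨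
            ζ i * (sB * ζ i ^ B)         ≈⟨ x∙yz≈y∙xz _ _ _ ⟩
            sB * ζ i ^ suc B
              ≈⟨ *-congˡ (reflexive (cong (λ q → ζ i ^ ((1 ℕ.∸ q) ℕ.+ B)) p)) ⟨
            sB * ζ i ^ plusExp τ y i     ∎
          action (swaps p ea eb) = sym (begin
            sB * ζ i ^ plusExp τ y i
              ≈⟨ *-congˡ (reflexive (cong (λ q → ζ i ^ ((1 ℕ.∸ q) ℕ.+ B)) p)) ⟩
            sB * ζ i ^ B                       ≈⟨ σ-C i (y ∷ʳ b) ⟩
            C i (τ (y ∷ʳ b))                   ≈⟨ reflexive (cong (C i) eb) ⟩
            C i (τ y ∷ʳ a)                     ≈⟨ C-compatible (τ y) i ⟩
            ζ i * C i (τ y ∷ʳ b)               ≈⟨ *-congˡ (reflexive (cong (C i) ea)) ⟨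
            ζ i * C i (τ (y ∷ʳ a))             ≈⟨ *-congˡ (σ-C i (y ∷ʳ a)) ⟨
            ζ i * (sA * ζ i ^ A)               ≈⟨ *-congˡ (*-congʳ sA≈σζsB) ⟩
            ζ i * ((σ (ζ i) * sB) * ζ i ^ A)   ≈⟨ *-congˡ (xy∙z≈y∙xz _ _ _) ⟩
            ζ i * (sB * (σ (ζ i) * ζ i ^ A))   ≈⟨ x∙yz≈y∙xz _ _ _ ⟩
            sB * (ζ i * (σ (ζ i) * ζ i ^ A))   ≈⟨ *-congˡ (x∙yz≈y∙xz _ _ _) ⟩
            sB * (σ (ζ i) * ζ i ^ suc A)
              ≈⟨ *-congˡ (*-congˡ (reflexive (cong (λ q → ζ i ^ (q ℕ.+ A)) p))) ⟨
            sB * (σ (ζ i) * ζ i ^ minusExp τ y i) ∎)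

        Pseq-≡-Pseq[]-mod-2^suc : ∀ i y → + (2 ℕ.^ suc i) ℤ.∣ Pseq τ y i ℤ.- Pseq τ [] i
        Pseq-≡-Pseq[]-mod-2^suc i y =
          ≡.subst (+ (2 ℕ.^ suc i) ℤ.∣_)
            (≡.sym (cong₂ ℤ._-_ (Pseq-plusExp-minusExp τ y i) (Pseq-plusExp-minusExp τ [] i)))
            (ζ-exponent-∣ i {u = minusExp τ y i} {plusExp τ y i} {minusExp τ [] i} {plusExp τ [] i}
                            (σ-ζ i y) (σ-ζ i []))

        Pseq-≡₂-Pseq[] : ∀ x → Pseq τ x ≡₂ Pseq τ []
        Pseq-≡₂-Pseq[] x zero    = ℕ.1∣ _
        Pseq-≡₂-Pseq[] x (suc i) = ℤ.∣⇒∣ᵤ (∣-difference-transfer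
          (Pseq τ x (suc i)) (Pseq τ x i) (Pseq τ [] (suc i)) (Pseq τ [] i)
          (Pseq-suc-∣ τ x i) (Pseq-suc-∣ τ [] i) (Pseq-≡-Pseq[]-mod-2^suc i x))

corollary3p3 : ∀ {c ℓ : Level} (L : CommutativeRing c ℓ) →
    let open FieldDefs L in
    IsField → CharNot2 →
    (K : Carrier → Set ℓ) → IsSubfield K →
    (x₀ : Carrier) → K x₀ → ¬ (x₀ ≈ 0#) → ¬ (x₀ ≈ - 1#) →
    (lab : Word → Carrier) → IsLabeling x₀ lab → GeneratedBy K lab →
    (ζ : ℕ → Carrier) → IsRootSystem ζ → LabelingCompatible lab ζ →
    (σ : Carrier → Carrier) → IsKAut K σ →
    (τ : Word → Word) → Induces lab σ τ →
    InM∞ τ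
corollary3p3 L isField _ K _ x₀ Kx₀ x₀≉0 x₀≉-1 lab isLabeling _ ζ isRootSystem compatible
             σ isKAut τ induces = τ-isTreeAut , Pseq-≡₂-Pseq[]
  where
  open RingTheory.Labeling L x₀ x₀≉0 x₀≉-1 lab isLabeling
  open InducedAction K Kx₀ σ isKAut τ induces
  open Basilica isField ζ isRootSystem compatible
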